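{- For any graph $H$ and any integer $k\ge 0$, every vertex $v\in V(L^{(k)}(H))$ satisfies $|\mathrm{Sh}(v)|\le k+1$.
   Context: Graphs are simple and undirected. For a graph $G=(V,E)$ the line graph $L(G)$ has vertex set $E$, with distinct $e,f\in E$ adjacent iff $e\cap f\neq\emptyset$; $L^{(0)}(H)=H$ and $L^{(j+1)}(H)=L(L^{(j)}(H))$. Thus a vertex of $L^{(j)}(H)$, $j\ge1$, is an unordered pair $\{u,w\}$ of vertices of $L^{(j-1)}(H)$. The shadow $\mathrm{Sh}(v)\subseteq V(H)$ is defined recursively: $\mathrm{Sh}(v)=\{v\}$ for $v\in V(H)$, and $\mathrm{Sh}(\{u,w\})=\mathrm{Sh}(u)\cup\mathrm{Sh}(w)$ for $v=\{u,w\}\in V(L^{(j)}(H))$, $j\ge1$. -}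

module Defs where

open import Data.Nat using (ℕ; zero; suc; _<ᵇ_)
open import Data.Bool using (Bool; true; false; _∧_; _∨_; if_then_else_)
open import Data.Fin using (Fin; toℕ; _≟_)
open import Data.Fin.Subset using (Subset; ⁅_⁆; _∪_)
open import Data.List using (List; []; _∷_; length; lookup; concatMap; allFin)
open import Data.Product using (_×_; _,_)
open import Relation.Nullary.Decidable using (⌊_⌋)

-- A finite simple graph on vertex set Fin n.  It is encoded by its "upper
-- triangle": for i < j (as naturals), i and j are adjacent iff adj i j ≡ true.
-- Entries adj i j with i ≥ j are ignored.  Every finite simple graph on
-- Fin n arises this way, and every such function determines a simple graph.
record Graph : Set where
  field
    n   : ℕ
    adj : Fin n → Fin n → Bool
open Graph public

Adjᵇ : (G : Graph) → Fin (n G) → Fin (n G) → Bool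
Adjᵇ G i j = ((toℕ i <ᵇ toℕ j) ∧ adj G i j) ∨ ((toℕ j <ᵇ toℕ i) ∧ adj G j i)

edges : (G : Graph) → List (Fin (n G) × Fin (n G))
edges G = concatMap (λ i → concatMap (λ j →
            if (toℕ i <ᵇ toℕ j) ∧ adj G i j then (i , j) ∷ [] else [])
            (allFin (n G))) (allFin (n G))

share : ∀ {m} → Fin m × Fin m → Fin m × Fin m → Bool
share (a , b) (c , d) =
  ⌊ a ≟ c ⌋ ∨ ⌊ a ≟ d ⌋ ∨ ⌊ b ≟ c ⌋ ∨ ⌊ b ≟ d ⌋

-- Line graph: vertex e : Fin (length (edges G)) is the edge  lookup (edges G) e.
-- Distinct edges e < f are adjacent iff they share an endpoint.
L : Graph → Graph
L G = record
  { n   = length (edges G)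
  ; adj = λ e f → (toℕ e <ᵇ toℕ f) ∧ share (lookup (edges G) e) (lookup (edges G) f)
  }

L^ : ℕ → Graph → Graph
L^ zero    H = H
L^ (suc j) H = L (L^ j H)

Sh : (j : ℕ) (H : Graph) → Fin (n (L^ j H)) → Subset (n H)
Sh zero    H v = ⁅ v ⁆
Sh (suc j) H v with lookup (edges (L^ j H)) v
... | (u , w) = Sh j H u ∪ Sh j H w

module Submission where

-- Call two vertex sets s, t of H *close* when each of them has at
-- most one element outside the other: |s ─ t| ≤ 1 and |t ─ s| ≤ 1.  The key
-- invariant is that the two endpoints of every edge of L^(j)(H) have close
-- shadows.  For j = 0 the shadows are singletons.  An edge of L^(j+1)(H)
-- joins two edges {a,b}, {c,d} of L^(j)(H) sharing an endpoint, say a = c;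
-- then Sh(a) ∪ Sh(b) and Sh(a) ∪ Sh(d) differ only inside Sh(b) ─ Sh(a) and
-- Sh(d) ─ Sh(a), which have at most one element each by induction.
-- The theorem follows: a vertex {u,w} of L^(k+1)(H) has shadow
-- Sh(u) ∪ Sh(w), of size at most |Sh(u)| + |Sh(w) ─ Sh(u)| ≤ (k + 1) + 1.

open import Defs
open import Data.Nat using (ℕ; zero; suc; _≤_; _+_; z≤n; s≤s; _<ᵇ_)
open import Data.Nat.Properties using (≤-trans; ≤-reflexive; +-suc; +-comm; +-mono-≤)
open import Data.Bool using (Bool; true; T; _∧_; if_then_else_)
open import Data.Bool.Properties using (T-∧)
open import Data.Unit using (tt)
open import Data.Fin using (Fin; toℕ; _≟_)
open import Data.Fin.Subset using (Subset; ∣_∣; _∪_; _─_; ⁅_⁆; inside; outside)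
open import Data.Fin.Subset.Properties using (∣⁅x⁆∣≡1; ∣p─q∣≤∣p∣; p─q─r≡p─q∪r; ∪-comm)
open import Data.Vec using ([]; _∷_)
open import Data.List using (List; []; _∷_; lookup; concatMap; allFin)
open import Data.List.Membership.Propositional using (_∈_)
open import Data.List.Membership.Propositional.Properties using (∈-lookup; ∈-concatMap⁻)
open import Data.List.Relation.Unary.Any using (here; satisfied)
open import Data.Product using (_×_; _,_; proj₂)
open import Data.Sum using (_⊎_; inj₁; inj₂)
open import Function.Bundles using (Equivalence)
open import Relation.Nullary using (yes; no)
open import Relation.Binary.PropositionalEquality using (_≡_; refl; sym; cong; subst; subst₂)

record Close {m} (s t : Subset m) : Set where
  constructor close
  field
    s-outside-t : ∣ s ─ t ∣ ≤ 1
    t-outside-s : ∣ t ─ s ∣ ≤ 1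
open Close public

close-sym : ∀ {m} {s t : Subset m} → Close s t → Close t s
close-sym (close s─t t─s) = close t─s s─t

close-⁅⁆ : ∀ {m} (a b : Fin m) → Close ⁅ a ⁆ ⁅ b ⁆
close-⁅⁆ a b = close (bound a b) (bound b a)
  where
  bound : ∀ x y → ∣ ⁅ x ⁆ ─ ⁅ y ⁆ ∣ ≤ 1
  bound x y = ≤-trans (∣p─q∣≤∣p∣ ⁅ x ⁆ ⁅ y ⁆) (≤-reflexive (∣⁅x⁆∣≡1 x))

∣p∪q∣≤∣p∣+∣q─p∣ : ∀ {m} (s t : Subset m) → ∣ s ∪ t ∣ ≤ ∣ s ∣ + ∣ t ─ s ∣
∣p∪q∣≤∣p∣+∣q─p∣ []            []            = z≤n
∣p∪q∣≤∣p∣+∣q─p∣ (inside  ∷ s) (_       ∷ t) = s≤s (∣p∪q∣≤∣p∣+∣q─p∣ s t)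
∣p∪q∣≤∣p∣+∣q─p∣ (outside ∷ s) (outside ∷ t) = ∣p∪q∣≤∣p∣+∣q─p∣ s t
∣p∪q∣≤∣p∣+∣q─p∣ (outside ∷ s) (inside  ∷ t) =
  subst (suc ∣ s ∪ t ∣ ≤_) (sym (+-suc ∣ s ∣ ∣ t ─ s ∣)) (s≤s (∣p∪q∣≤∣p∣+∣q─p∣ s t))

[p∪q]─p≡q─p : ∀ {m} (s t : Subset m) → (s ∪ t) ─ s ≡ t ─ s
[p∪q]─p≡q─p []            []      = refl
[p∪q]─p≡q─p (inside  ∷ s) (_ ∷ t) = cong (outside ∷_) ([p∪q]─p≡q─p s t)
[p∪q]─p≡q─p (outside ∷ s) (x ∷ t) = cong (x ∷_) ([p∪q]─p≡q─p s t)

∣[p∪q]─[p∪r]∣≤∣q─p∣ : ∀ {m} (s t u : Subset m) → ∣ (s ∪ t) ─ (s ∪ u) ∣ ≤ ∣ t ─ s ∣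
∣[p∪q]─[p∪r]∣≤∣q─p∣ s t u =
  subst (λ x → ∣ x ∣ ≤ ∣ t ─ s ∣) (p─q─r≡p─q∪r (s ∪ t) s u)
    (subst (λ x → ∣ x ─ u ∣ ≤ ∣ t ─ s ∣) (sym ([p∪q]─p≡q─p s t))
      (∣p─q∣≤∣p∣ (t ─ s) u))

close-∪ : ∀ {m} {s t u : Subset m} → Close s t → Close s u → Close (s ∪ t) (s ∪ u)
close-∪ {s = s} {t} {u} (close _ t─s) (close _ u─s) = close
  (≤-trans (∣[p∪q]─[p∪r]∣≤∣q─p∣ s t u) t─s)
  (≤-trans (∣[p∪q]─[p∪r]∣≤∣q─p∣ s u t) u─s)

∈-if-singleton : ∀ {A : Set} (b : Bool) {x y : A} →
  x ∈ (if b then y ∷ [] else []) → T b × x ≡ y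
∈-if-singleton true (here x≡y) = tt , x≡y

edgeᵇ : (G : Graph) → Fin (n G) → Fin (n G) → Bool
edgeᵇ G i j = (toℕ i <ᵇ toℕ j) ∧ adj G i j

edgeCell : (G : Graph) → Fin (n G) → Fin (n G) → List (Fin (n G) × Fin (n G))
edgeCell G i j = if edgeᵇ G i j then (i , j) ∷ [] else []

edgeRow : (G : Graph) → Fin (n G) → List (Fin (n G) × Fin (n G))
edgeRow G i = concatMap (edgeCell G i) (allFin (n G))

listed-edge-adjacent : ∀ (G : Graph) {u w : Fin (n G)} → (u , w) ∈ edges G → T (adj G u w)
listed-edge-adjacent G uw∈E
  with satisfied (∈-concatMap⁻ (edgeRow G) {allFin (n G)} uw∈E)
... | i , uw∈row with satisfied (∈-concatMap⁻ (edgeCell G i) {allFin (n G)} uw∈row)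
... | j , uw∈cell with ∈-if-singleton (edgeᵇ G i j) uw∈cell
... | isEdge , refl = proj₂ (Equivalence.to T-∧ isEdge)

share-endpoint : ∀ {m} (a b c d : Fin m) → T (share (a , b) (c , d)) →
  a ≡ c ⊎ a ≡ d ⊎ b ≡ c ⊎ b ≡ d
share-endpoint a b c d s with a ≟ c | a ≟ d | b ≟ c | b ≟ d
... | yes a≡c | _       | _       | _       = inj₁ a≡c
... | no _    | yes a≡d | _       | _       = inj₂ (inj₁ a≡d)
... | no _    | no _    | yes b≡c | _       = inj₂ (inj₂ (inj₁ b≡c))
... | no _    | no _    | no _    | yes b≡d = inj₂ (inj₂ (inj₂ b≡d))

line-edge-share : ∀ (G : Graph) {x y : Fin (n (L G))} → (x , y) ∈ edges (L G) →
  T (share (lookup (edges G) x) (lookup (edges G) y))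
line-edge-share G xy∈E = proj₂ (Equivalence.to T-∧ (listed-edge-adjacent (L G) xy∈E))

ShPair : (j : ℕ) (H : Graph) → Fin (n (L^ j H)) × Fin (n (L^ j H)) → Subset (n H)
ShPair j H (u , w) = Sh j H u ∪ Sh j H w

Sh-suc : ∀ (j : ℕ) (H : Graph) (v : Fin (n (L^ (suc j) H))) →
  Sh (suc j) H v ≡ ShPair j H (lookup (edges (L^ j H)) v)
Sh-suc j H v with lookup (edges (L^ j H)) v
... | u , w = refl

shared-endpoint-close : ∀ {m N} (S : Fin m → Subset N) {a b c d : Fin m} →
  Close (S a) (S b) → Close (S c) (S d) → T (share (a , b) (c , d)) →
  Close (S a ∪ S b) (S c ∪ S d)
shared-endpoint-close S {a} {b} {c} {d} ab cd s with share-endpoint a b c d s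
... | inj₁ refl = close-∪ ab cd
... | inj₂ (inj₁ refl) =
  subst (Close (S a ∪ S b)) (∪-comm (S a) (S c)) (close-∪ ab (close-sym cd))
... | inj₂ (inj₂ (inj₁ refl)) =
  subst (λ x → Close x (S c ∪ S d)) (∪-comm (S b) (S a)) (close-∪ (close-sym ab) cd)
... | inj₂ (inj₂ (inj₂ refl)) =
  subst₂ Close (∪-comm (S b) (S a)) (∪-comm (S b) (S c))
    (close-∪ (close-sym ab) (close-sym cd))

edge-shadows-close : ∀ (j : ℕ) (H : Graph) {u w : Fin (n (L^ j H))} →
  (u , w) ∈ edges (L^ j H) → Close (Sh j H u) (Sh j H w)
edge-shadows-close zero    H {u} {w} _  = close-⁅⁆ u w
edge-shadows-close (suc j) H {x} {y} xy∈E =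
  subst₂ Close (sym (Sh-suc j H x)) (sym (Sh-suc j H y))
    (ends-close (lookup E x) (lookup E y) (∈-lookup x) (∈-lookup y)
      (line-edge-share (L^ j H) xy∈E))
  where
  E : List (Fin (n (L^ j H)) × Fin (n (L^ j H)))
  E = edges (L^ j H)
  ends-close : ∀ p q → p ∈ E → q ∈ E → T (share p q) → Close (ShPair j H p) (ShPair j H q)
  ends-close (a , b) (c , d) ab∈E cd∈E =
    shared-endpoint-close (Sh j H) (edge-shadows-close j H ab∈E) (edge-shadows-close j H cd∈E)

mainTheorem5 : (H : Graph) (k : ℕ) (v : Fin (n (L^ k H))) → ∣ Sh k H v ∣ ≤ suc k
mainTheorem5 H zero    v = ≤-reflexive (∣⁅x⁆∣≡1 v)
mainTheorem5 H (suc k) v =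
  subst (λ s → ∣ s ∣ ≤ suc (suc k)) (sym (Sh-suc k H v))
    (pair-bound (lookup (edges (L^ k H)) v) (∈-lookup v))
  where
  pair-bound : ∀ p → p ∈ edges (L^ k H) → ∣ ShPair k H p ∣ ≤ suc (suc k)
  pair-bound (u , w) uw∈E =
    ≤-trans (∣p∪q∣≤∣p∣+∣q─p∣ (Sh k H u) (Sh k H w))
      (subst (∣ Sh k H u ∣ + ∣ Sh k H w ─ Sh k H u ∣ ≤_) (+-comm (suc k) 1)
        (+-mono-≤ (mainTheorem5 H k u) (t-outside-s (edge-shadows-close k H uw∈E))))
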